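{- Let $G$ be a cubic graph and $S\subseteq V(G)$. Then $S$ is a DET:OLD set of $G$ if and only if $G$ contains no $4$-cycle and for all distinct $u,v\in V(G)\setminus S$, $u\notin T_2(v)\cup T_4(v)$.
   Context: For a graph $G$ and $v\in V(G)$, $N(v)$ is the open neighborhood of $v$. For $S\subseteq V(G)$ write $N_S(v)=N(v)\cap S$. A set $S\subseteq V(G)$ is a DET:OLD set of $G$ if (1) every vertex $v$ satisfies $|N_S(v)|\ge 2$, and (2) every pair of distinct vertices $u,v$ satisfies $|N_S(u)\setminus N_S(v)|\ge 2$ or $|N_S(v)\setminus N_S(u)|\ge 2$. A cubic graph is a 3-regular simple graph. A trail of length $k$ is a walk $v_0v_1\cdots v_k$ whose $k$ edges $v_{i-1}v_i$ are pairwise distinct; $T_k(v)$ denotes the set of vertices $w$ such that there is a trail of length $k$ from $v$ to $w$. -}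

module Defs where

open import Data.Nat using (ℕ; zero; suc; _≥_)
open import Data.Bool using (Bool; true; false)
open import Data.Fin using (Fin; zero; suc; inject₁)
open import Data.Fin.Subset using (Subset; _∩_; ∁; ∣_∣; _∈_; _∉_)
open import Data.Vec using (tabulate)
open import Data.Product using (_×_; Σ; ∃; ∃-syntax)
open import Data.Sum using (_⊎_)
open import Relation.Binary.PropositionalEquality using (_≡_; _≢_)
open import Relation.Nullary using (¬_)

record Graph (n : ℕ) : Set where
  field
    adj     : Fin n → Fin n → Bool
    sym     : ∀ u v → adj u v ≡ adj v u
    irrefl  : ∀ v → adj v v ≡ false

open Graph public

N : ∀ {n} → Graph n → Fin n → Subset n
N G v = tabulate (adj G v)

N[_] : ∀ {n} → Graph n → Subset n → Fin n → Subset n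
N[ G ] S v = N G v ∩ S

Cubic : ∀ {n} → Graph n → Set
Cubic G = ∀ v → ∣ N G v ∣ ≡ 3

diffSize : ∀ {n} → Subset n → Subset n → ℕ
diffSize A B = ∣ A ∩ ∁ B ∣

DetOLD : ∀ {n} → Graph n → Subset n → Set
DetOLD G S =
  (∀ v → ∣ N[ G ] S v ∣ ≥ 2) ×
  (∀ u v → u ≢ v →
     (diffSize (N[ G ] S u) (N[ G ] S v) ≥ 2) ⊎ (diffSize (N[ G ] S v) (N[ G ] S u) ≥ 2))

Adj : ∀ {n} → Graph n → Fin n → Fin n → Set
Adj G u v = adj G u v ≡ true

Has4Cycle : ∀ {n} → Graph n → Set
Has4Cycle {n} G = ∃[ a ] ∃[ b ] ∃[ c ] ∃[ d ]
  ((a ≢ b × a ≢ c × a ≢ d × b ≢ c × b ≢ d × c ≢ d) ×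
   (Adj G a b × Adj G b c × Adj G c d × Adj G d a))

SameEdge : ∀ {n} → Fin n → Fin n → Fin n → Fin n → Set
SameEdge a b c d = (a ≡ c × b ≡ d) ⊎ (a ≡ d × b ≡ c)

record Trail {n} (G : Graph n) (k : ℕ) (v w : Fin n) : Set where
  field
    p        : Fin (suc k) → Fin n
    start    : p zero ≡ v
    end      : p (Data.Fin.fromℕ k) ≡ w
    adjacent : ∀ (i : Fin k) → Adj G (p (inject₁ i)) (p (suc i))
    distinct : ∀ (i j : Fin k) → i ≢ j →
                 ¬ SameEdge (p (inject₁ i)) (p (suc i)) (p (inject₁ j)) (p (suc j))

InT : ∀ {n} → Graph n → ℕ → Fin n → Fin n → Set
InT G k v w = Trail G k v w

-- In a cubic graph a vertex has only three neighbours, so a subset of N(z) that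
-- misses two of them has at most one element. Hence two non-S vertices joined by
-- a 2-trail leave their middle vertex with |N_S| ≤ 1, and the two ends of a 4-cycle
-- diagonal, or the second and fourth vertex of a 4-trail between non-S vertices,
-- have |N_S(u) \ N_S(v)| ≤ 1 in both directions. Conversely, if u cannot separate
-- itself from v, two of its three neighbours are non-S or adjacent to v; without
-- 2-trails between non-S vertices and without 4-cycles this leaves a non-S
-- neighbour x of u and a common neighbour w of u and v. Doing the same from v
-- (with the same w, since u and v share only one neighbour) gives a non-S
-- neighbour y of v, and x u w v y is a forbidden 4-trail.
module Submission where

open import Defs hiding (sym)
open import Data.Nat using (ℕ; zero; suc; _+_; _≤_; _<_; _≥_; s≤s)
open import Data.Nat.Properties using (suc-injective; ≤-pred; <⇒≱; module ≤-Reasoning)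
open import Data.Fin using (Fin; zero; suc; inject₁; _≟_)
open import Data.Fin.Subset
  using (Subset; inside; outside; _∩_; _─_; _-_; ∁; ⊥; ⁅_⁆; ∣_∣; _∈_; _∉_; _⊆_; Nonempty)
open import Data.Fin.Subset.Properties
  using ( _∈?_; nonempty?; Empty-unique; ∣⊥∣≡0; ∉⊥; ⊥⊆; ⊆-trans; x∈⁅x⁆; p─⊥≡p
        ; p⊆q⇒∣p∣≤∣q∣; p─q⊆p; p∩q⊆p; x∈p∩q⁺; x∈p∩q⁻; x∈∁p⇒x∉p; x∉p⇒x∈∁p
        ; x∈p∧x≢y⇒x∈p-y)
open import Data.Vec using (_∷_; tabulate; here; there)
open import Data.Vec.Properties using (lookup⇒[]=; []=⇒lookup; lookup∘tabulate)
open import Data.Product using (_×_; _,_; ∃-syntax; proj₁; proj₂)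
open import Data.Sum using (_⊎_; inj₁; inj₂; [_,_]′)
import Data.Sum as Sum
open import Data.Empty using (⊥-elim)
open import Function using (_∘_)
open import Function.Bundles using (_⇔_; mk⇔)
open import Relation.Binary.PropositionalEquality using (_≡_; _≢_; refl; sym; trans; cong; subst)
open import Relation.Nullary using (¬_; yes; no; contradiction)
open import Relation.Nullary.Decidable using (toSum)

private variable
  n k : ℕ
  p q : Subset n
  x y : Fin n

∣p∣≡1+∣p-x∣ : x ∈ p → ∣ p ∣ ≡ suc ∣ p - x ∣
∣p∣≡1+∣p-x∣ {p = inside ∷ p} here = cong (suc ∘ ∣_∣) (sym (p─⊥≡p p))
∣p∣≡1+∣p-x∣ {p = inside ∷ p} (there x∈p) = cong suc (∣p∣≡1+∣p-x∣ x∈p)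
∣p∣≡1+∣p-x∣ {p = outside ∷ p} (there x∈p) = ∣p∣≡1+∣p-x∣ x∈p

x∈p─q⇒x∉q : x ∈ p ─ q → x ∉ q
x∈p─q⇒x∉q {p = inside ∷ _} {q = outside ∷ _} here ()
x∈p─q⇒x∉q {p = _ ∷ _} {q = _ ∷ _} (there x∈p─q) (there x∈q) = x∈p─q⇒x∉q x∈p─q x∈q

x∈p-y⁻ : x ∈ p - y → x ∈ p × x ≢ y
x∈p-y⁻ {p = p} {y = y} x∈p-y = p─q⊆p p ⁅ y ⁆ x∈p-y , λ { refl → x∈p─q⇒x∉q x∈p-y (x∈⁅x⁆ y) }

∣p∣≡1+k⇒Nonempty : ∀ {n k} {p : Subset n} → ∣ p ∣ ≡ suc k → Nonempty p
∣p∣≡1+k⇒Nonempty {n = n} {p = p} eq with nonempty? p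
... | yes ne = ne
... | no  e  = contradiction (trans (sym eq) (trans (cong ∣_∣ (Empty-unique e)) (∣⊥∣≡0 n))) λ ()

remove-one : ∣ p ∣ ≡ suc k → ∃[ x ] (x ∈ p × ∣ p - x ∣ ≡ k)
remove-one eq with ∣p∣≡1+k⇒Nonempty eq
... | x , x∈p = x , x∈p , suc-injective (trans (sym (∣p∣≡1+∣p-x∣ x∈p)) eq)

∣p∣≡3⇒three-elements : ∣ p ∣ ≡ 3 →
  ∃[ a ] ∃[ b ] ∃[ c ] ((a ∈ p × b ∈ p × c ∈ p) × (a ≢ b × a ≢ c × b ≢ c))
∣p∣≡3⇒three-elements eq with remove-one eq
... | a , a∈p , eq₂ with remove-one eq₂
... | b , b∈p-a , eq₁ with remove-one eq₁
... | c , c∈p-a-b , _ with x∈p-y⁻ b∈p-a | x∈p-y⁻ c∈p-a-b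
... | b∈p , b≢a | c∈p-a , c≢b with x∈p-y⁻ c∈p-a
... | c∈p , c≢a = a , b , c , (a∈p , b∈p , c∈p) , (b≢a ∘ sym , c≢a ∘ sym , c≢b ∘ sym)

2+∣p∣≤∣q∣ : p ⊆ q → x ∈ q → y ∈ q → x ≢ y → x ∉ p → y ∉ p → 2 + ∣ p ∣ ≤ ∣ q ∣
2+∣p∣≤∣q∣ {p = p} {q = q} {x = x} {y = y} p⊆q x∈q y∈q x≢y x∉p y∉p = begin
  2 + ∣ p ∣          ≤⟨ s≤s (s≤s (p⊆q⇒∣p∣≤∣q∣ p⊆q-x-y)) ⟩
  2 + ∣ q - x - y ∣  ≡⟨ cong suc (∣p∣≡1+∣p-x∣ y∈q-x) ⟨
  suc ∣ q - x ∣      ≡⟨ ∣p∣≡1+∣p-x∣ x∈q ⟨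
  ∣ q ∣              ∎
  where
  open ≤-Reasoning
  y∈q-x : y ∈ q - x
  y∈q-x = x∈p∧x≢y⇒x∈p-y y∈q (x≢y ∘ sym)
  p⊆q-x-y : p ⊆ q - x - y
  p⊆q-x-y z∈p = x∈p∧x≢y⇒x∈p-y (x∈p∧x≢y⇒x∈p-y (p⊆q z∈p) λ { refl → x∉p z∈p })
                               λ { refl → y∉p z∈p }

2≤∣p∣ : ∀ {n} {p : Subset n} {x y} → x ∈ p → y ∈ p → x ≢ y → 2 ≤ ∣ p ∣
2≤∣p∣ {n} {p} x∈p y∈p x≢y =
  subst (λ k → 2 + k ≤ ∣ p ∣) (∣⊥∣≡0 n) (2+∣p∣≤∣q∣ (⊥⊆ {p = p}) x∈p y∈p x≢y ∉⊥ ∉⊥)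

TwoDistinct : {A : Set} → (A → Set) → Set
TwoDistinct P = ∃[ x ] ∃[ y ] (P x × P y × x ≢ y)

pigeonhole₃ : {A : Set} {P Q : A → Set} {a b c : A} → a ≢ b → a ≢ c → b ≢ c →
  P a ⊎ Q a → P b ⊎ Q b → P c ⊎ Q c → TwoDistinct P ⊎ TwoDistinct Q
pigeonhole₃ a≢b a≢c b≢c (inj₁ pa) (inj₁ pb) _         = inj₁ (_ , _ , pa , pb , a≢b)
pigeonhole₃ a≢b a≢c b≢c (inj₁ pa) (inj₂ qb) (inj₁ pc) = inj₁ (_ , _ , pa , pc , a≢c)
pigeonhole₃ a≢b a≢c b≢c (inj₁ pa) (inj₂ qb) (inj₂ qc) = inj₂ (_ , _ , qb , qc , b≢c)
pigeonhole₃ a≢b a≢c b≢c (inj₂ qa) (inj₁ pb) (inj₁ pc) = inj₁ (_ , _ , pb , pc , b≢c)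
pigeonhole₃ a≢b a≢c b≢c (inj₂ qa) (inj₁ pb) (inj₂ qc) = inj₂ (_ , _ , qa , qc , a≢c)
pigeonhole₃ a≢b a≢c b≢c (inj₂ qa) (inj₂ qb) _         = inj₂ (_ , _ , qa , qb , a≢b)

module _ {n : ℕ} (G : Graph n) where

  Adj-sym : Adj G x y → Adj G y x
  Adj-sym {x = x} {y = y} xy = trans (Graph.sym G y x) xy

  Adj⇒≢ : Adj G x y → x ≢ y
  Adj⇒≢ {x = x} xy refl with trans (sym xy) (irrefl G x)
  ... | ()

  Adj⇒∈N : Adj G x y → y ∈ N G x
  Adj⇒∈N {x = x} {y = y} xy = lookup⇒[]= y (tabulate (adj G x)) (trans (lookup∘tabulate (adj G x) y) xy)

  ∈N⇒Adj : y ∈ N G x → Adj G x y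
  ∈N⇒Adj {y = y} {x = x} y∈Nx = trans (sym (lookup∘tabulate (adj G x) y)) ([]=⇒lookup y∈Nx)

  ∈N[S]⁺ : ∀ {S v} → Adj G v x → x ∈ S → x ∈ N[ G ] S v
  ∈N[S]⁺ vx x∈S = x∈p∩q⁺ (Adj⇒∈N vx , x∈S)

  ∈N[S]⁻ : ∀ {S v} → x ∈ N[ G ] S v → Adj G v x × x ∈ S
  ∈N[S]⁻ {S = S} {v = v} x∈NSv with x∈p∩q⁻ (N G v) S x∈NSv
  ... | x∈Nv , x∈S = ∈N⇒Adj x∈Nv , x∈S

  ¬C4⇒common-neighbour-unique : ¬ Has4Cycle G → ∀ {u v} → u ≢ v →
    Adj G u x → Adj G v x → Adj G u y → Adj G v y → x ≡ y
  ¬C4⇒common-neighbour-unique {x = x} {y = y} ¬C4 {u} {v} u≢v ux vx uy vy with x ≟ y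
  ... | yes x≡y = x≡y
  ... | no  x≢y = ⊥-elim (¬C4 (u , x , v , y ,
          (Adj⇒≢ ux , u≢v , Adj⇒≢ uy , Adj⇒≢ vx ∘ sym , x≢y , Adj⇒≢ vy) ,
          (ux , Adj-sym vx , vy , Adj-sym uy)))

  trail₂⇒path : Trail G 2 x y → ∃[ z ] (Adj G x z × Adj G z y)
  trail₂⇒path t =
    walk (suc zero) , subst (λ a → Adj G a _) start (adjacent zero) , subst (Adj G _) end (adjacent (suc zero))
    where open Trail t renaming (p to walk)

  trail₄⇒walk : Trail G 4 x y → ∃[ a ] ∃[ b ] ∃[ c ]
    ((Adj G x a × Adj G a b × Adj G b c × Adj G c y) × (x ≢ b × a ≢ c × b ≢ y))
  trail₄⇒walk t =
    walk (suc zero) , walk (suc (suc zero)) , walk (suc (suc (suc zero))) ,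
    ( subst (λ a → Adj G a _) start (adjacent zero) , adjacent (suc zero)
    , adjacent (suc (suc zero)) , subst (Adj G _) end (adjacent (suc (suc (suc zero)))) ) ,
    ( (λ e → distinct zero (suc zero) (λ ()) (inj₂ (trans start e , refl)))
    , (λ e → distinct (suc zero) (suc (suc zero)) (λ ()) (inj₂ (e , refl)))
    , (λ e → distinct (suc (suc zero)) (suc (suc (suc zero))) (λ ()) (inj₂ (trans e (sym end) , refl))) )
    where open Trail t renaming (p to walk)

  private
    ¬SameEdge : ∀ {a b c d : Fin n} → (a ≡ c → b ≢ d) → (a ≡ d → b ≢ c) → ¬ SameEdge a b c d
    ¬SameEdge f g (inj₁ (a≡c , b≡d)) = f a≡c b≡d
    ¬SameEdge f g (inj₂ (a≡d , b≡c)) = g a≡d b≡c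

    SameEdge-sym : ∀ {a b c d : Fin n} → SameEdge a b c d → SameEdge c d a b
    SameEdge-sym (inj₁ (a≡c , b≡d)) = inj₁ (sym a≡c , sym b≡d)
    SameEdge-sym (inj₂ (a≡d , b≡c)) = inj₂ (sym b≡c , sym a≡d)

  path⇒trail₂ : ∀ {z} → Adj G x z → Adj G z y → x ≢ y → Trail G 2 x y
  path⇒trail₂ {x = x} {y = y} {z = z} xz zy x≢y = record
    { p = walk ; start = refl ; end = refl ; adjacent = adjacent ; distinct = distinct }
    where
    walk : Fin 3 → Fin n
    walk zero             = x
    walk (suc zero)       = z
    walk (suc (suc zero)) = y
    adjacent : ∀ i → Adj G (walk (inject₁ i)) (walk (suc i))
    adjacent zero       = xz
    adjacent (suc zero) = zy
    e₀₁ : ¬ SameEdge x z z y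
    e₀₁ = ¬SameEdge (λ x≡z _ → Adj⇒≢ xz x≡z) (λ x≡y _ → x≢y x≡y)
    distinct : ∀ i j → i ≢ j → ¬ SameEdge (walk (inject₁ i)) (walk (suc i)) (walk (inject₁ j)) (walk (suc j))
    distinct zero       zero       i≢j = ⊥-elim (i≢j refl)
    distinct zero       (suc zero) _   = e₀₁
    distinct (suc zero) zero       _   = e₀₁ ∘ SameEdge-sym
    distinct (suc zero) (suc zero) i≢j = ⊥-elim (i≢j refl)

  walk⇒trail₄ : ∀ {a b c} → Adj G x a → Adj G a b → Adj G b c → Adj G c y →
    x ≢ b → a ≢ c → b ≢ y → ¬ (x ≡ c × a ≡ y) → Trail G 4 x y
  walk⇒trail₄ {x = x} {y = y} {a = a} {b = b} {c = c} xa ab bc cy x≢b a≢c b≢y ¬x≡c×a≡y = record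
    { p = walk ; start = refl ; end = refl ; adjacent = adjacent ; distinct = distinct }
    where
    walk : Fin 5 → Fin n
    walk zero                         = x
    walk (suc zero)                   = a
    walk (suc (suc zero))             = b
    walk (suc (suc (suc zero)))       = c
    walk (suc (suc (suc (suc zero)))) = y
    adjacent : ∀ i → Adj G (walk (inject₁ i)) (walk (suc i))
    adjacent zero                   = xa
    adjacent (suc zero)             = ab
    adjacent (suc (suc zero))       = bc
    adjacent (suc (suc (suc zero))) = cy
    e₀₁ : ¬ SameEdge x a a b
    e₀₁ = ¬SameEdge (λ _ a≡b → Adj⇒≢ ab a≡b) (λ x≡b _ → x≢b x≡b)
    e₀₂ : ¬ SameEdge x a b c
    e₀₂ = ¬SameEdge (λ _ a≡c → a≢c a≡c) (λ _ a≡b → Adj⇒≢ ab a≡b)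
    e₀₃ : ¬ SameEdge x a c y
    e₀₃ = ¬SameEdge (λ x≡c a≡y → ¬x≡c×a≡y (x≡c , a≡y)) (λ _ a≡c → a≢c a≡c)
    e₁₂ : ¬ SameEdge a b b c
    e₁₂ = ¬SameEdge (λ a≡b _ → Adj⇒≢ ab a≡b) (λ a≡c _ → a≢c a≡c)
    e₁₃ : ¬ SameEdge a b c y
    e₁₃ = ¬SameEdge (λ a≡c _ → a≢c a≡c) (λ _ b≡c → Adj⇒≢ bc b≡c)
    e₂₃ : ¬ SameEdge b c c y
    e₂₃ = ¬SameEdge (λ b≡c _ → Adj⇒≢ bc b≡c) (λ b≡y _ → b≢y b≡y)
    distinct : ∀ i j → i ≢ j → ¬ SameEdge (walk (inject₁ i)) (walk (suc i)) (walk (inject₁ j)) (walk (suc j))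
    distinct zero                   (suc zero)               _ = e₀₁
    distinct zero                   (suc (suc zero))         _ = e₀₂
    distinct zero                   (suc (suc (suc zero)))   _ = e₀₃
    distinct (suc zero)             (suc (suc zero))         _ = e₁₂
    distinct (suc zero)             (suc (suc (suc zero)))   _ = e₁₃
    distinct (suc (suc zero))       (suc (suc (suc zero)))   _ = e₂₃
    distinct (suc zero)             zero                     _ = e₀₁ ∘ SameEdge-sym
    distinct (suc (suc zero))       zero                     _ = e₀₂ ∘ SameEdge-sym
    distinct (suc (suc (suc zero))) zero                     _ = e₀₃ ∘ SameEdge-sym
    distinct (suc (suc zero))       (suc zero)               _ = e₁₂ ∘ SameEdge-sym
    distinct (suc (suc (suc zero))) (suc zero)               _ = e₁₃ ∘ SameEdge-sym
    distinct (suc (suc (suc zero))) (suc (suc zero))         _ = e₂₃ ∘ SameEdge-sym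
    distinct zero                   zero                   i≢j = ⊥-elim (i≢j refl)
    distinct (suc zero)             (suc zero)             i≢j = ⊥-elim (i≢j refl)
    distinct (suc (suc zero))       (suc (suc zero))       i≢j = ⊥-elim (i≢j refl)
    distinct (suc (suc (suc zero))) (suc (suc (suc zero))) i≢j = ⊥-elim (i≢j refl)

module _ {n : ℕ} (G : Graph n) (cubic : Cubic G) where

  neighbour-pigeonhole : ∀ {P Q : Fin n → Set} v → (∀ {x} → Adj G v x → P x ⊎ Q x) →
    TwoDistinct (λ x → Adj G v x × P x) ⊎ TwoDistinct (λ x → Adj G v x × Q x)
  neighbour-pigeonhole {P = P} {Q = Q} v split with ∣p∣≡3⇒three-elements (cubic v)
  ... | a , b , c , (a∈N , b∈N , c∈N) , (a≢b , a≢c , b≢c) =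
    pigeonhole₃ a≢b a≢c b≢c (tag a∈N) (tag b∈N) (tag c∈N)
    where
    tag : ∀ {x} → x ∈ N G v → (Adj G v x × P x) ⊎ (Adj G v x × Q x)
    tag x∈N = let vx = ∈N⇒Adj G x∈N in Sum.map (vx ,_) (vx ,_) (split vx)

  ∣p∣<2 : ∀ {p : Subset n} {x y z} → p ⊆ N G z → Adj G z x → Adj G z y → x ≢ y → x ∉ p → y ∉ p → ∣ p ∣ < 2
  ∣p∣<2 {z = z} p⊆N zx zy x≢y x∉p y∉p =
    ≤-pred (subst (_ ≤_) (cubic z) (2+∣p∣≤∣q∣ p⊆N (Adj⇒∈N G zx) (Adj⇒∈N G zy) x≢y x∉p y∉p))

module _ {n : ℕ} (G : Graph n) (cubic : Cubic G) (S : Subset n) where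

  diffSize<2 : ∀ {z w a b : Fin n} → Adj G z a → Adj G z b → a ≢ b →
    (a ∈ S → Adj G w a) → (b ∈ S → Adj G w b) → diffSize (N[ G ] S z) (N[ G ] S w) < 2
  diffSize<2 {z} {w} za zb a≢b a-seen b-seen =
    ∣p∣<2 G cubic (⊆-trans (p∩q⊆p (N[ G ] S z) _) (p∩q⊆p (N G z) S)) za zb a≢b (∉diff a-seen) (∉diff b-seen)
    where
    ∉diff : ∀ {x} → (x ∈ S → Adj G w x) → x ∉ N[ G ] S z ∩ ∁ (N[ G ] S w)
    ∉diff seen x∈diff with x∈p∩q⁻ (N[ G ] S z) _ x∈diff
    ... | x∈NSz , x∈∁NSw =
      let x∈S = proj₂ (∈N[S]⁻ G x∈NSz) in x∈∁p⇒x∉p x∈∁NSw (∈N[S]⁺ G (seen x∈S) x∈S)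

  module _ (det : DetOLD G S) where

    private
      not-both-diffSize<2 : ∀ {u v} → u ≢ v → diffSize (N[ G ] S u) (N[ G ] S v) < 2 →
        ¬ diffSize (N[ G ] S v) (N[ G ] S u) < 2
      not-both-diffSize<2 {u} {v} u≢v uv<2 vu<2 = [ <⇒≱ uv<2 , <⇒≱ vu<2 ]′ (proj₂ det u v u≢v)

    DetOLD⇒¬C4 : ¬ Has4Cycle G
    DetOLD⇒¬C4 (a , b , c , d , (_ , a≢c , _ , _ , b≢d , _) , (ab , bc , cd , da)) =
      not-both-diffSize<2 a≢c
        (diffSize<2 ab (Adj-sym G da) b≢d (λ _ → Adj-sym G bc) (λ _ → cd))
        (diffSize<2 (Adj-sym G bc) cd b≢d (λ _ → ab) (λ _ → Adj-sym G da))

    DetOLD⇒¬T₂ : x ∉ S → y ∉ S → x ≢ y → ¬ Trail G 2 x y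
    DetOLD⇒¬T₂ x∉S y∉S x≢y t with trail₂⇒path G t
    ... | z , xz , zy =
      <⇒≱ (∣p∣<2 G cubic (p∩q⊆p (N G z) S) (Adj-sym G xz) zy x≢y
                 (x∉S ∘ proj₂ ∘ ∈N[S]⁻ G) (y∉S ∘ proj₂ ∘ ∈N[S]⁻ G))
          (proj₁ det z)

    DetOLD⇒¬T₄ : x ∉ S → y ∉ S → ¬ Trail G 4 x y
    DetOLD⇒¬T₄ x∉S y∉S t with trail₄⇒walk G t
    ... | a , b , c , (xa , ab , bc , cy) , (x≢b , a≢c , b≢y) =
      not-both-diffSize<2 a≢c
        (diffSize<2 (Adj-sym G xa) ab x≢b (⊥-elim ∘ x∉S) (λ _ → Adj-sym G bc))
        (diffSize<2 cy (Adj-sym G bc) (b≢y ∘ sym) (⊥-elim ∘ y∉S) (λ _ → ab))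

  module _ (¬C4 : ¬ Has4Cycle G)
           (¬T : ∀ u v → u ∉ S → v ∉ S → u ≢ v → ¬ (InT G 2 v u ⊎ InT G 4 v u)) where

    private
      ¬T₂ : x ∉ S → y ∉ S → x ≢ y → ¬ Trail G 2 x y
      ¬T₂ x∉S y∉S x≢y = ¬T _ _ y∉S x∉S (x≢y ∘ sym) ∘ inj₁

      ¬T₄ : x ∉ S → y ∉ S → x ≢ y → ¬ Trail G 4 x y
      ¬T₄ x∉S y∉S x≢y = ¬T _ _ y∉S x∉S (x≢y ∘ sym) ∘ inj₂

      common-neighbour-unique : ∀ {u v} → u ≢ v →
        Adj G u x → Adj G v x → Adj G u y → Adj G v y → x ≡ y
      common-neighbour-unique = ¬C4⇒common-neighbour-unique G ¬C4

    outside-neighbour-unique : ∀ {z} → Adj G z x → Adj G z y → x ∉ S → y ∉ S → x ≡ y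
    outside-neighbour-unique {x = x} {y = y} zx zy x∉S y∉S with x ≟ y
    ... | yes x≡y = x≡y
    ... | no  x≢y = ⊥-elim (¬T₂ x∉S y∉S x≢y (path⇒trail₂ G (Adj-sym G zx) zy x≢y))

    ∣N[S]∣≥2 : ∀ v → ∣ N[ G ] S v ∣ ≥ 2
    ∣N[S]∣≥2 v with neighbour-pigeonhole G cubic v (λ {x} _ → toSum (x ∈? S))
    ... | inj₁ (x , y , (vx , x∈S) , (vy , y∈S) , x≢y) = 2≤∣p∣ (∈N[S]⁺ G vx x∈S) (∈N[S]⁺ G vy y∈S) x≢y
    ... | inj₂ (x , y , (vx , x∉S) , (vy , y∉S) , x≢y) = ⊥-elim (x≢y (outside-neighbour-unique vx vy x∉S y∉S))

    -- The walk x u w v: the first half of a 4-trail from a vertex x ∉ S.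
    HalfTrail : Fin n → Fin n → Set
    HalfTrail u v = ∃[ x ] ∃[ w ] (Adj G u x × x ∉ S × Adj G u w × Adj G v w × x ≢ w)

    private
      Blocked : Fin n → Fin n → Set
      Blocked v x = x ∉ S ⊎ Adj G v x

      separating⊎blocked : ∀ {u v} → Adj G u x →
        x ∈ N[ G ] S u ∩ ∁ (N[ G ] S v) ⊎ Blocked v x
      separating⊎blocked {x = x} {v = v} ux with x ∈? S | x ∈? N[ G ] S v
      ... | no  x∉S | _        = inj₂ (inj₁ x∉S)
      ... | yes _   | yes x∈NSv = inj₂ (inj₂ (proj₁ (∈N[S]⁻ G x∈NSv)))
      ... | yes x∈S | no  x∉NSv = inj₁ (x∈p∩q⁺ (∈N[S]⁺ G ux x∈S , x∉p⇒x∈∁p x∉NSv))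

      two-blocked⇒HalfTrail : ∀ {u v} → u ≢ v →
        TwoDistinct (λ x → Adj G u x × Blocked v x) → HalfTrail u v
      two-blocked⇒HalfTrail u≢v (x , y , (ux , inj₁ x∉S) , (uy , inj₁ y∉S) , x≢y) =
        ⊥-elim (x≢y (outside-neighbour-unique ux uy x∉S y∉S))
      two-blocked⇒HalfTrail u≢v (x , y , (ux , inj₂ vx) , (uy , inj₂ vy) , x≢y) =
        ⊥-elim (x≢y (common-neighbour-unique u≢v ux vx uy vy))
      two-blocked⇒HalfTrail u≢v (x , y , (ux , inj₁ x∉S) , (uy , inj₂ vy) , x≢y) =
        x , y , ux , x∉S , uy , vy , x≢y
      two-blocked⇒HalfTrail u≢v (x , y , (ux , inj₂ vx) , (uy , inj₁ y∉S) , x≢y) =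
        y , x , uy , y∉S , ux , vx , x≢y ∘ sym

    diffSize≥2⊎HalfTrail : ∀ {u v} → u ≢ v →
      diffSize (N[ G ] S u) (N[ G ] S v) ≥ 2 ⊎ HalfTrail u v
    diffSize≥2⊎HalfTrail {u} u≢v with neighbour-pigeonhole G cubic u separating⊎blocked
    ... | inj₁ (x , y , (_ , x∈diff) , (_ , y∈diff) , x≢y) = inj₁ (2≤∣p∣ x∈diff y∈diff x≢y)
    ... | inj₂ two-blocked = inj₂ (two-blocked⇒HalfTrail u≢v two-blocked)

    -- Both halves meet in the same w, as u and v have only one common neighbour.
    ¬opposite-HalfTrails : ∀ {u v} → u ≢ v → HalfTrail u v → ¬ HalfTrail v u
    ¬opposite-HalfTrails {u} {v} u≢v (x , w , ux , x∉S , uw , vw , x≢w) (y , w′ , vy , y∉S , vw′ , uw′ , y≢w′)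
      with common-neighbour-unique u≢v uw vw uw′ vw′
    ... | refl = ¬T₄ x∉S y∉S x≢y
                   (walk⇒trail₄ G (Adj-sym G ux) uw (Adj-sym G vw) vy x≢w u≢v (y≢w′ ∘ sym) ¬x≡v×u≡y)
      where
      x≢y : x ≢ y
      x≢y refl = x≢w (common-neighbour-unique u≢v ux vy uw vw)
      ¬x≡v×u≡y : ¬ (x ≡ v × u ≡ y)
      ¬x≡v×u≡y (refl , refl) = ¬T₂ y∉S x∉S u≢v (path⇒trail₂ G uw (Adj-sym G vw) u≢v)

    ¬C4∧¬T⇒DetOLD : DetOLD G S
    ¬C4∧¬T⇒DetOLD = ∣N[S]∣≥2 , separated
      where
      separated : ∀ u v → u ≢ v →
        diffSize (N[ G ] S u) (N[ G ] S v) ≥ 2 ⊎ diffSize (N[ G ] S v) (N[ G ] S u) ≥ 2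
      separated u v u≢v with diffSize≥2⊎HalfTrail u≢v | diffSize≥2⊎HalfTrail (u≢v ∘ sym)
      ... | inj₁ uv≥2 | _          = inj₁ uv≥2
      ... | inj₂ _    | inj₁ vu≥2  = inj₂ vu≥2
      ... | inj₂ h    | inj₂ h′    = ⊥-elim (¬opposite-HalfTrails u≢v h h′)

corollary11 : ∀ {n} (G : Graph n) → Cubic G → (S : Subset n) →
    DetOLD G S ⇔
      (¬ Has4Cycle G ×
       (∀ u v → u ∉ S → v ∉ S → u ≢ v → ¬ (InT G 2 v u ⊎ InT G 4 v u)))
corollary11 G cubic S = mk⇔
  (λ det → DetOLD⇒¬C4 G cubic S det ,
           λ u v u∉S v∉S u≢v → [ DetOLD⇒¬T₂ G cubic S det v∉S u∉S (u≢v ∘ sym)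
                               , DetOLD⇒¬T₄ G cubic S det v∉S u∉S ]′)
  (λ (¬C4 , ¬T) → ¬C4∧¬T⇒DetOLD G cubic S ¬C4 ¬T)
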